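{- For every $r\geq 2$, the graph $G_r$ is $6$-$\gamma_{tR}$-edge-supercritical.
   Context: All graphs are finite and simple. For $r\geq 2$, $G_r$ is defined as follows. Start with the complete graph $K_{2r}$ on vertices $u_1,\dots,u_r,w_1,\dots,w_r$ and delete the perfect matching $\{u_iw_i:1\leq i\leq r\}$. Add a disjoint triangle on new vertices $x,y,z$. Join $z$ to every $u_i$ and every $w_i$ ($1\leq i\leq r$), and join $y$ to every $u_i$ ($1\leq i\leq r$). Finally add two new vertices $u_0,w_0$ with edges $u_0x$, $w_0y$, $u_0u_i$ and $w_0w_i$ for $1\leq i\leq r$. (So $G_r$ has $2r+5$ vertices.) A total Roman dominating function (TRD-function) on a graph $G$ with no isolated vertices is a function $f:V(G)\to\{0,1,2\}$ such that every vertex $v$ with $f(v)=0$ is adjacent to some $u$ with $f(u)=2$, and the subgraph induced by $\{w:f(w)>0\}$ has no isolated vertices; its weight is $\sum_v f(v)$ and $\gamma_{tR}(G)$ is the minimum weight. A graph $G$ with no isolated vertices is $k$-$\gamma_{tR}$-edge-supercritical if $\gamma_{tR}(G)=k$, $E(\overline{G})\neq\emptyset$, and $\gamma_{tR}(G+e)\leq\gamma_{tR}(G)-2$ for every $e\in E(\overline{G})$. -}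

module Defs where

open import Data.Nat using (ℕ; zero; suc; _+_; _≤_; _<_; _∸_)
open import Data.Bool using (Bool; true; false; _∨_; _∧_; not; T)
open import Data.Fin using (Fin; splitAt; _≟_)
open import Data.Sum using (_⊎_; inj₁; inj₂)
open import Data.Product using (Σ; _×_; _,_; ∃; ∃-syntax)
open import Data.List using (map; allFin)
open import Data.Nat.ListAction using (sum)
open import Relation.Nullary using (¬_)
open import Relation.Nullary.Decidable using (⌊_⌋)
open import Relation.Binary.PropositionalEquality using (_≡_)

-- Graphs: a graph on n vertices is given by a Boolean adjacency
-- function on Fin n (intended symmetric and irreflexive: simple graph).

Graph : ℕ → Set
Graph n = Fin n → Fin n → Bool

Adj : ∀ {n} → Graph n → Fin n → Fin n → Set
Adj G a b = T (G a b)

IsSimple : ∀ {n} → Graph n → Set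
IsSimple {n} G = (∀ a b → G a b ≡ G b a) × (∀ a → G a a ≡ false)

NoIsolated : ∀ {n} → Graph n → Set
NoIsolated {n} G = ∀ (v : Fin n) → ∃[ u ] Adj G v u

NonEdge : ∀ {n} → Graph n → Fin n → Fin n → Set
NonEdge G a b = ¬ (a ≡ b) × ¬ Adj G a b

addEdge : ∀ {n} → Graph n → Fin n → Fin n → Graph n
addEdge G a b c d =
  G c d ∨ ((⌊ c ≟ a ⌋ ∧ ⌊ d ≟ b ⌋) ∨ (⌊ c ≟ b ⌋ ∧ ⌊ d ≟ a ⌋))

-- f : V → {0,1,2}, encoded as ℕ-valued with values ≤ 2
IsTRDF : ∀ {n} → Graph n → (Fin n → ℕ) → Set
IsTRDF {n} G f =
    (∀ v → f v ≤ 2)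
  × (∀ v → f v ≡ 0 → ∃[ u ] (Adj G v u × f u ≡ 2))
  × (∀ v → 1 ≤ f v → ∃[ u ] (Adj G v u × 1 ≤ f u))

weight : ∀ {n} → (Fin n → ℕ) → ℕ
weight {n} f = sum (map f (allFin n))

γtR≤ : ∀ {n} → Graph n → ℕ → Set
γtR≤ G k = ∃[ f ] (IsTRDF G f × weight f ≤ k)

γtR≡ : ∀ {n} → Graph n → ℕ → Set
γtR≡ G k = (∃[ f ] (IsTRDF G f × weight f ≡ k))
         × (∀ f → IsTRDF G f → k ≤ weight f)

EdgeSupercritical : ∀ {n} → ℕ → Graph n → Set
EdgeSupercritical {n} k G =
    NoIsolated G
  × γtR≡ G k
  × (∃[ a ] ∃[ b ] NonEdge G a b)
  × (∀ a b → NonEdge G a b → γtR≤ (addEdge G a b) (k ∸ 2))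

data Vtx (r : ℕ) : Set where
  x y z u₀ w₀ : Vtx r
  u w : Fin r → Vtx r

neq : ∀ {r} → Fin r → Fin r → Bool
neq i j = not ⌊ i ≟ j ⌋

vadj : ∀ {r} → Vtx r → Vtx r → Bool
-- K_{2r} minus the perfect matching {u_i w_i}
vadj (u i) (u j) = neq i j
vadj (w i) (w j) = neq i j
vadj (u i) (w j) = neq i j
vadj (w i) (u j) = neq i j
vadj x y = true
vadj y x = true
vadj x z = true
vadj z x = true
vadj y z = true
vadj z y = true
vadj z (u _) = true
vadj (u _) z = true
vadj z (w _) = true
vadj (w _) z = true
vadj y (u _) = true
vadj (u _) y = true
vadj u₀ x = true
vadj x u₀ = true
vadj w₀ y = true
vadj y w₀ = true
vadj u₀ (u _) = true
vadj (u _) u₀ = true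
vadj w₀ (w _) = true
vadj (w _) w₀ = true
vadj _ _ = false

-- vertex numbering of Fin (5 + (r + r)): 0..4 = x,y,z,u₀,w₀,
-- then u_1..u_r, then w_1..w_r
decode : ∀ {r} → Fin (5 + (r + r)) → Vtx r
decode Fin.zero = x
decode (Fin.suc Fin.zero) = y
decode (Fin.suc (Fin.suc Fin.zero)) = z
decode (Fin.suc (Fin.suc (Fin.suc Fin.zero))) = u₀
decode (Fin.suc (Fin.suc (Fin.suc (Fin.suc Fin.zero)))) = w₀
decode {r} (Fin.suc (Fin.suc (Fin.suc (Fin.suc (Fin.suc i))))) with splitAt r i
... | inj₁ j = u j
... | inj₂ j = w j

G : (r : ℕ) → Graph (5 + (r + r))
G r a b = vadj (decode {r} a) (decode {r} b)

module Submission where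

-- Upper bounds come from total domination: if every vertex has a neighbour in D,
-- then 2 on D and 0 elsewhere is a TRD-function, so γtR ≤ 2|D|.  The triangle xyz
-- totally dominates G_r, and for each of the eleven kinds of non-edge e some pair
-- of vertices totally dominates G_r + e.
--
-- For the lower bound write the weight as A + B + f(z) with
-- A = f(u₀) + f(x) + Σ f(u_i) and B = f(w₀) + f(y) + Σ f(w_i).  Every vertex v has
-- a heavy neighbour t: f(t) ≥ 1 and f(v) + f(t) ≥ 2.  As N(u₀) lies in A and N(w₀)
-- in B, A, B ≥ 2, which settles f(z) = 2.  So let f(z) ≤ 1; then z dominates
-- nothing.  If A = 2, then f(y) = 2 (forced by x, or by the u_i, which are then
-- all 0) unless two w_i have weight 2.  Also f(w₀) + f(z) + Σ f(w_i) ≥ 2: otherwise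
-- every w_i has its heavy neighbour among the u_j with j ≠ i, and following two
-- such neighbours gives Σ f(u_j) ≥ 3 > A.  So B + f(z) ≥ 4.  Dually B = 2 gives
-- A + f(z) ≥ 4: if f(y) ≥ 1 the w_i vanish and need two u_j of weight 2; if
-- f(y) = 0, the weight-2 neighbour of y is x, and the same crossing argument runs
-- from the u_i to the w_j, or it is some u_l, and then the heavy neighbour of x
-- already lies in A + f(z).

open import Defs
open import Data.Bool using (Bool; false; T; if_then_else_; _∧_)
open import Data.Bool.Properties using (T-∨; T-∧)
open import Data.Empty using (⊥; ⊥-elim)
open import Data.Fin using (Fin; zero; suc; _≟_; _↑ˡ_; _↑ʳ_; splitAt; punchIn; punchOut; fromℕ<)
open import Data.Fin.Properties using (punchIn-punchOut; punchInᵢ≢i; splitAt-↑ˡ; splitAt-↑ʳ; join-splitAt)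
open import Data.List using (List; []; _∷_; length; map; tabulate)
open import Data.List.Properties using (map-tabulate)
open import Data.List.Membership.Propositional using (_∈_)
open import Data.List.Membership.Propositional.Properties using (∈-map⁺)
open import Data.List.Relation.Unary.Any using (here; there)
open import Data.Nat using (ℕ; zero; suc; _+_; _*_; _≤_; z≤n; s≤s; _≤?_)
open import Data.Nat.Properties
  using ( +-assoc; +-comm; +-identityʳ; +-mono-≤; +-monoʳ-≤; +-monoˡ-≤; +-cancelˡ-≤; +-cancelʳ-≤
        ; ≤-refl; ≤-reflexive; ≤-trans; ≤-antisym; ≤-pred; ≰⇒>; <⇒≱; m≤m+n; m≤n+m; n≤0⇒n≡0; 1+n≰n
        ; *-suc; +-0-commutativeMonoid; +-commutativeSemigroup; module ≤-Reasoning )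
import Data.Nat.ListAction as ListAction
open import Data.Nat.Tactic.RingSolver using (solve-∀)
open import Data.Product using (_×_; _,_; proj₁; proj₂; ∃-syntax)
open import Data.Sum using (_⊎_; inj₁; inj₂; [_,_]′) renaming (map to ⊎-map)
open import Data.Unit using (tt)
open import Function using (_∘_; id; case_of_)
open import Function.Bundles using (module Equivalence)
open import Relation.Nullary using (¬_; does; yes; no; contradiction)
open import Relation.Nullary.Decidable using (⌊_⌋; dec-true; dec-false; fromWitness)
open import Relation.Binary.PropositionalEquality

open import Algebra.Properties.CommutativeMonoid.Sum +-0-commutativeMonoid
  using (sum-remove; sum-cong-≗; sum-replicate-zero; ∑-distrib-+) renaming (sum to ∑)
open import Algebra.Properties.CommutativeSemigroup +-commutativeSemigroup using (xy∙z≈xz∙y)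
open Equivalence using (from)

≤1⇒≢2 : ∀ {n} → n ≤ 1 → n ≢ 2
≤1⇒≢2 z≤n ()
≤1⇒≢2 (s≤s z≤n) ()

≡0⇒≢2 : ∀ {n} → n ≡ 0 → n ≢ 2
≡0⇒≢2 refl ()

≡0⊎≥1 : ∀ n → n ≡ 0 ⊎ 1 ≤ n
≡0⊎≥1 zero = inj₁ refl
≡0⊎≥1 (suc _) = inj₂ (s≤s z≤n)

m+n≤k≤m⇒n≡0 : ∀ {m n k} → k ≤ m → m + n ≤ k → n ≡ 0
m+n≤k≤m⇒n≡0 {m} {n} k≤m m+n≤k =
  n≤0⇒n≡0 (+-cancelˡ-≤ m n 0 (≤-trans m+n≤k (≤-trans k≤m (≤-reflexive (sym (+-identityʳ m))))))

sum-tabulate : ∀ {n} (f : Fin n → ℕ) → ListAction.sum (tabulate f) ≡ ∑ f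
sum-tabulate {zero} f = refl
sum-tabulate {suc n} f = cong (f zero +_) (sum-tabulate (f ∘ suc))

weight≡∑ : ∀ {n} (f : Fin n → ℕ) → weight f ≡ ∑ f
weight≡∑ f = trans (cong ListAction.sum (map-tabulate id f)) (sum-tabulate f)

∑-++ : ∀ m {n} (f : Fin (m + n) → ℕ) → ∑ f ≡ ∑ (f ∘ (_↑ˡ n)) + ∑ (f ∘ (m ↑ʳ_))
∑-++ zero f = refl
∑-++ (suc m) f = trans (cong (f zero +_) (∑-++ m (f ∘ suc))) (sym (+-assoc (f zero) _ _))

∑-mono-≤ : ∀ {n} {f g : Fin n → ℕ} → (∀ i → f i ≤ g i) → ∑ f ≤ ∑ g
∑-mono-≤ {zero} f≤g = z≤n
∑-mono-≤ {suc n} f≤g = +-mono-≤ (f≤g zero) (∑-mono-≤ (f≤g ∘ suc))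

term≤∑ : ∀ {n} (f : Fin n → ℕ) i → f i ≤ ∑ f
term≤∑ {suc n} f i = ≤-trans (m≤m+n (f i) _) (≤-reflexive (sym (sum-remove f)))

twoTerms≤∑ : ∀ {n} (f : Fin n → ℕ) {i j} → i ≢ j → f i + f j ≤ ∑ f
twoTerms≤∑ {suc n} f {i} {j} i≢j = begin
  f i + f j                           ≡⟨ cong (λ k → f i + f k) (punchIn-punchOut i≢j) ⟨
  f i + f (punchIn i (punchOut i≢j))  ≤⟨ +-monoʳ-≤ (f i) (term≤∑ (f ∘ punchIn i) (punchOut i≢j)) ⟩
  f i + ∑ (f ∘ punchIn i)             ≡⟨ sum-remove f ⟨
  ∑ f                                 ∎
  where open ≤-Reasoning

∑-pointMass : ∀ {n} (d : Fin n) k → ∑ (λ v → if does (v ≟ d) then k else 0) ≡ k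
∑-pointMass {suc n} d k = begin
  ∑ mass                          ≡⟨ sum-remove {i = d} mass ⟩
  mass d + ∑ (mass ∘ punchIn d)   ≡⟨ cong₂ _+_ (cong (if_then k else 0) (dec-true (d ≟ d) refl))
                                               (sum-cong-≗ (cong (if_then k else 0) ∘ punchIn-miss)) ⟩
  k + ∑ {n} (λ _ → 0)             ≡⟨ cong (k +_) (sum-replicate-zero n) ⟩
  k + 0                           ≡⟨ +-identityʳ k ⟩
  k                               ∎
  where
  open ≡-Reasoning
  mass : Fin (suc n) → ℕ
  mass v = if does (v ≟ d) then k else 0
  punchIn-miss : ∀ j → does (punchIn d j ≟ d) ≡ false
  punchIn-miss j = dec-false (punchIn d j ≟ d) (punchInᵢ≢i d j)

∑≥4-or : ∀ {r} {P : Set} {g : Fin r → ℕ} → Fin r →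
         (∀ i → P ⊎ ∃[ j ] (j ≢ i × g j ≡ 2)) → P ⊎ 4 ≤ ∑ g
∑≥4-or {g = g} i₀ twoElsewhere with twoElsewhere i₀
... | inj₁ p = inj₁ p
... | inj₂ (j , _ , gj≡2) with twoElsewhere j
...   | inj₁ p = inj₁ p
...   | inj₂ (m , m≢j , gm≡2) =
  inj₂ (subst (_≤ ∑ g) (cong₂ _+_ gj≡2 gm≡2) (twoTerms≤∑ g (m≢j ∘ sym)))

∑≥3-of-crossing : ∀ {r} → 2 ≤ r → {f g : Fin r → ℕ} → ∑ f ≤ 1 →
                  (∀ i → ∃[ j ] (j ≢ i × 1 ≤ g j × 2 ≤ f i + g j)) → 3 ≤ ∑ g
∑≥3-of-crossing {suc (suc _)} (s≤s (s≤s _)) {f} {g} ∑f≤1 cross =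
  let k , fk≡0 = zeroAt
      j , _ , _ , 2≤fk+gj = cross k
      m , m≢j , 1≤gm , _ = cross j
  in ≤-trans (+-mono-≤ (subst (λ n → 2 ≤ n + g j) fk≡0 2≤fk+gj) 1≤gm) (twoTerms≤∑ g (m≢j ∘ sym))
  where
  zeroAt : ∃[ k ] f k ≡ 0
  zeroAt with ≡0⊎≥1 (f zero)
  ... | inj₁ f0≡0 = zero , f0≡0
  ... | inj₂ 1≤f0 = suc zero ,
    m+n≤k≤m⇒n≡0 1≤f0 (≤-trans (twoTerms≤∑ f {zero} {suc zero} (λ ())) ∑f≤1)

IsTRDFOn : {V : Set} → (V → V → Bool) → (V → ℕ) → Set
IsTRDFOn E f = (∀ v → f v ≤ 2)
             × (∀ v → f v ≡ 0 → ∃[ t ] (T (E v t) × f t ≡ 2))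
             × (∀ v → 1 ≤ f v → ∃[ t ] (T (E v t) × 1 ≤ f t))

heavyNeighbour : ∀ {V : Set} {E : V → V → Bool} {f : V → ℕ} → IsTRDFOn E f →
                 ∀ v → ∃[ t ] (T (E v t) × 1 ≤ f t × 2 ≤ f v + f t)
heavyNeighbour {f = f} (_ , dominated , total) v with ≡0⊎≥1 (f v)
... | inj₁ fv≡0 = let t , v~t , two = dominated v fv≡0 in
  t , v~t , subst (1 ≤_) (sym two) (s≤s z≤n) , subst (2 ≤_) (sym (cong₂ _+_ fv≡0 two)) ≤-refl
... | inj₂ 1≤fv = let t , v~t , 1≤ft = total v 1≤fv in t , v~t , 1≤ft , +-mono-≤ 1≤fv 1≤ft

γtR≡-intro : ∀ {n} {G : Graph n} {k} → γtR≤ G k → (∀ f → IsTRDF G f → k ≤ weight f) → γtR≡ G k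
γtR≡-intro (f , trdf , weight≤k) lower = (f , trdf , ≤-antisym weight≤k (lower f trdf)) , lower

TotallyDominates : ∀ {n} → Graph n → List (Fin n) → Set
TotallyDominates G D = ∀ v → ∃[ d ] (d ∈ D × Adj G v d)

TotallyDominates⇒NoIsolated : ∀ {n} {G : Graph n} {D} → TotallyDominates G D → NoIsolated G
TotallyDominates⇒NoIsolated dom v = let d , _ , v~d = dom v in d , v~d

2·𝟙 : ∀ {n} → List (Fin n) → Fin n → ℕ
2·𝟙 [] v = 0
2·𝟙 (d ∷ D) v = if does (v ≟ d) then 2 else 2·𝟙 D v

2·𝟙≤2 : ∀ {n} (D : List (Fin n)) v → 2·𝟙 D v ≤ 2
2·𝟙≤2 [] v = z≤n
2·𝟙≤2 (d ∷ D) v with v ≟ d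
... | yes _ = ≤-refl
... | no _ = 2·𝟙≤2 D v

2·𝟙-∈ : ∀ {n} {D : List (Fin n)} {v} → v ∈ D → 2·𝟙 D v ≡ 2
2·𝟙-∈ {D = d ∷ D} {v} v∈D with v ≟ d | v∈D
... | yes _ | _ = refl
... | no v≢d | here v≡d = contradiction v≡d v≢d
... | no _ | there v∈D′ = 2·𝟙-∈ v∈D′

∑-2·𝟙 : ∀ {n} (D : List (Fin n)) → ∑ (2·𝟙 D) ≤ 2 * length D
∑-2·𝟙 {n} [] = ≤-reflexive (sum-replicate-zero n)
∑-2·𝟙 {n} (d ∷ D) = begin
  ∑ (2·𝟙 (d ∷ D))                         ≤⟨ ∑-mono-≤ split ⟩
  ∑ (λ v → mass v + 2·𝟙 D v)              ≡⟨ ∑-distrib-+ mass (2·𝟙 D) ⟩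
  ∑ mass + ∑ (2·𝟙 D)                      ≤⟨ +-mono-≤ (≤-reflexive (∑-pointMass d 2)) (∑-2·𝟙 D) ⟩
  2 + 2 * length D                        ≡⟨ *-suc 2 (length D) ⟨
  2 * length (d ∷ D)                      ∎
  where
  open ≤-Reasoning
  mass : Fin n → ℕ
  mass v = if does (v ≟ d) then 2 else 0
  split : ∀ v → 2·𝟙 (d ∷ D) v ≤ mass v + 2·𝟙 D v
  split v with v ≟ d
  ... | yes _ = m≤m+n 2 _
  ... | no _ = ≤-refl

γtR≤-totalDomination : ∀ {n} (G : Graph n) (D : List (Fin n)) → TotallyDominates G D →
                       γtR≤ G (2 * length D)
γtR≤-totalDomination G D dom =
  2·𝟙 D , (2·𝟙≤2 D , (λ v _ → twoNeighbour v) , λ v _ → positiveNeighbour v) , weight≤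
  where
  twoNeighbour : ∀ v → ∃[ d ] (Adj G v d × 2·𝟙 D d ≡ 2)
  twoNeighbour v = let d , d∈D , v~d = dom v in d , v~d , 2·𝟙-∈ d∈D
  positiveNeighbour : ∀ v → ∃[ d ] (Adj G v d × 1 ≤ 2·𝟙 D d)
  positiveNeighbour v = let d , v~d , two = twoNeighbour v in d , v~d , subst (1 ≤_) (sym two) (s≤s z≤n)
  weight≤ : weight (2·𝟙 D) ≤ 2 * length D
  weight≤ = ≤-trans (≤-reflexive (weight≡∑ (2·𝟙 D))) (∑-2·𝟙 D)

addEdge-⊇ : ∀ {n} (G : Graph n) a b {c d} → Adj G c d → Adj (addEdge G a b) c d
addEdge-⊇ G a b {c} {d} c~d = from (T-∨ {G c d}) (inj₁ c~d)

addEdge-new : ∀ {n} (G : Graph n) a b → Adj (addEdge G a b) a b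
addEdge-new G a b = from (T-∨ {G a b}) (inj₂ (from (T-∨ {⌊ a ≟ a ⌋ ∧ ⌊ b ≟ b ⌋})
  (inj₁ (from (T-∧ {⌊ a ≟ a ⌋}) (fromWitness refl , fromWitness refl)))))

addEdge-new′ : ∀ {n} (G : Graph n) a b → Adj (addEdge G a b) b a
addEdge-new′ G a b = from (T-∨ {G b a}) (inj₂ (from (T-∨ {⌊ b ≟ a ⌋ ∧ ⌊ a ≟ b ⌋})
  (inj₂ (from (T-∧ {⌊ b ≟ b ⌋}) (fromWitness refl , fromWitness refl)))))

encode : ∀ {r} → Vtx r → Fin (5 + (r + r))
encode x = zero
encode y = suc zero
encode z = suc (suc zero)
encode u₀ = suc (suc (suc zero))
encode w₀ = suc (suc (suc (suc zero)))
encode {r} (u i) = 5 ↑ʳ (i ↑ˡ r)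
encode {r} (w i) = 5 ↑ʳ (r ↑ʳ i)

decode-encode : ∀ {r} (p : Vtx r) → decode (encode p) ≡ p
decode-encode x = refl
decode-encode y = refl
decode-encode z = refl
decode-encode u₀ = refl
decode-encode w₀ = refl
decode-encode {r} (u i) rewrite splitAt-↑ˡ r i r = refl
decode-encode {r} (w i) rewrite splitAt-↑ʳ r r i = refl

encode-decode : ∀ {r} (a : Fin (5 + (r + r))) → encode (decode {r} a) ≡ a
encode-decode zero = refl
encode-decode (suc zero) = refl
encode-decode (suc (suc zero)) = refl
encode-decode (suc (suc (suc zero))) = refl
encode-decode (suc (suc (suc (suc zero)))) = refl
encode-decode {r} (suc (suc (suc (suc (suc i))))) with splitAt r i | join-splitAt r r i
... | inj₁ j | i≡j = cong (5 ↑ʳ_) i≡j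
... | inj₂ j | i≡j = cong (5 ↑ʳ_) i≡j

vadj⇒Adj : ∀ {r} {p q : Vtx r} → T (vadj p q) → Adj (G r) (encode p) (encode q)
vadj⇒Adj {p = p} {q} = subst₂ (λ p′ q′ → T (vadj p′ q′)) (sym (decode-encode p)) (sym (decode-encode q))

IsTRDF-encode : ∀ {r} {f : Fin (5 + (r + r)) → ℕ} → IsTRDF (G r) f → IsTRDFOn vadj (f ∘ encode {r})
IsTRDF-encode {r} {f} (bounded , dominated , total) =
    bounded ∘ encode
  , (λ p → pull {_≡ 2} p ∘ dominated (encode p))
  , (λ p → pull {1 ≤_} p ∘ total (encode p))
  where
  pull : ∀ {P : ℕ → Set} (p : Vtx r) →
         ∃[ t ] (Adj (G r) (encode p) t × P (f t)) → ∃[ q ] (T (vadj p q) × P (f (encode q)))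
  pull {P} p (t , p~t , Pt) =
      decode {r} t
    , subst (λ p′ → T (vadj p′ (decode {r} t))) (decode-encode p) p~t
    , subst (P ∘ f) (sym (encode-decode t)) Pt

uSide wSide : ∀ {r} → (Vtx r → ℕ) → ℕ
uSide F = F u₀ + F x + ∑ (F ∘ u)
wSide F = F w₀ + F y + ∑ (F ∘ w)

weight-sides : ∀ {r} (f : Fin (5 + (r + r)) → ℕ) →
               weight f ≡ uSide (f ∘ encode {r}) + wSide (f ∘ encode {r}) + f (encode {r} z)
weight-sides {r} f = begin
  weight f                                          ≡⟨ weight≡∑ f ⟩
  F x + (F y + (F z + (F u₀ + (F w₀ + ∑ (f ∘ (5 ↑ʳ_))))))
    ≡⟨ cong (λ s → F x + (F y + (F z + (F u₀ + (F w₀ + s))))) (∑-++ r (f ∘ (5 ↑ʳ_))) ⟩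
  F x + (F y + (F z + (F u₀ + (F w₀ + (∑ (F ∘ u) + ∑ (F ∘ w))))))
    ≡⟨ regroup (F x) (F y) (F z) (F u₀) (F w₀) (∑ (F ∘ u)) (∑ (F ∘ w)) ⟩
  uSide F + wSide F + F z                           ∎
  where
  open ≡-Reasoning
  F : Vtx r → ℕ
  F = f ∘ encode
  regroup : ∀ a b c a₀ b₀ U W →
            a + (b + (c + (a₀ + (b₀ + (U + W))))) ≡ (a₀ + a + U) + (b₀ + b + W) + c
  regroup = solve-∀

neq⇒≢ : ∀ {r} {i j : Fin r} → T (neq i j) → i ≢ j
neq⇒≢ {i = i} {j} i≠j with i ≟ j
... | no i≢j = i≢j

¬neq⇒≡ : ∀ {r} {i j : Fin r} → ¬ T (neq i j) → i ≡ j
¬neq⇒≡ {i = i} {j} ¬i≠j with i ≟ j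
... | yes i≡j = i≡j
... | no _ = contradiction tt ¬i≠j

≢⇒neq : ∀ {r} {i j : Fin r} → i ≢ j → T (neq i j)
≢⇒neq {i = i} {j} i≢j with i ≟ j
... | yes i≡j = i≢j i≡j
... | no _ = tt

neq-either : ∀ {r} (l : Fin r) {i j} → i ≢ j → T (neq l i) ⊎ T (neq l j)
neq-either l {i} i≢j with l ≟ i
... | yes refl = inj₂ (≢⇒neq i≢j)
... | no _ = inj₁ tt

another : ∀ {r} → 2 ≤ r → (i : Fin r) → ∃[ j ] i ≢ j
another (s≤s (s≤s _)) zero = suc zero , λ ()
another (s≤s (s≤s _)) (suc _) = zero , λ ()

module LowerBound {r} (2≤r : 2 ≤ r) {F : Vtx r → ℕ} (trdf : IsTRDFOn vadj F) where

  U W A B : ℕ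
  U = ∑ (F ∘ u)
  W = ∑ (F ∘ w)
  A = uSide F
  B = wSide F

  private
    dominated : ∀ v → F v ≡ 0 → ∃[ t ] (T (vadj v t) × F t ≡ 2)
    dominated = proj₁ (proj₂ trdf)

    heavy : ∀ v → ∃[ t ] (T (vadj v t) × 1 ≤ F t × 2 ≤ F v + F t)
    heavy = heavyNeighbour trdf

    i₀ : Fin r
    i₀ = fromℕ< 2≤r

    regroup : ∀ a b c d → b + (c + (d + a)) ≡ a + b + c + d
    regroup = solve-∀

  u₀+neighbour≤A : ∀ {t} → T (vadj u₀ t) → F u₀ + F t ≤ A
  u₀+neighbour≤A {x} _ = m≤m+n (F u₀ + F x) U
  u₀+neighbour≤A {u i} _ =
    ≤-trans (+-monoʳ-≤ (F u₀) (term≤∑ (F ∘ u) i)) (+-monoˡ-≤ U (m≤m+n (F u₀) (F x)))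

  w₀+neighbour≤B : ∀ {t} → T (vadj w₀ t) → F w₀ + F t ≤ B
  w₀+neighbour≤B {y} _ = m≤m+n (F w₀ + F y) W
  w₀+neighbour≤B {w i} _ =
    ≤-trans (+-monoʳ-≤ (F w₀) (term≤∑ (F ∘ w) i)) (+-monoˡ-≤ W (m≤m+n (F w₀) (F y)))

  A≥2 : 2 ≤ A
  A≥2 = let _ , u₀~t , _ , heavyPair = heavy u₀ in ≤-trans heavyPair (u₀+neighbour≤A u₀~t)

  B≥2 : 2 ≤ B
  B≥2 = let _ , w₀~t , _ , heavyPair = heavy w₀ in ≤-trans heavyPair (w₀+neighbour≤B w₀~t)

  A≤2⇒Fu₀≤1 : A ≤ 2 → F u₀ ≤ 1
  A≤2⇒Fu₀≤1 A≤2 = let _ , u₀~t , 1≤Ft , _ = heavy u₀ in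
    +-cancelʳ-≤ 1 (F u₀) 1 (≤-trans (+-monoʳ-≤ (F u₀) 1≤Ft) (≤-trans (u₀+neighbour≤A u₀~t) A≤2))

  B≤2⇒Fw₀≤1 : B ≤ 2 → F w₀ ≤ 1
  B≤2⇒Fw₀≤1 B≤2 = let _ , w₀~t , 1≤Ft , _ = heavy w₀ in
    +-cancelʳ-≤ 1 (F w₀) 1 (≤-trans (+-monoʳ-≤ (F w₀) 1≤Ft) (≤-trans (w₀+neighbour≤B w₀~t) B≤2))

  A≤2⇒Fx≥1⇒Fu≡0 : A ≤ 2 → 1 ≤ F x → ∀ i → F (u i) ≡ 0
  A≤2⇒Fx≥1⇒Fu≡0 A≤2 1≤Fx i with heavy u₀
  ... | x , _ , _ , heavyPair =
    n≤0⇒n≡0 (≤-trans (term≤∑ (F ∘ u) i) (≤-reflexive (m+n≤k≤m⇒n≡0 heavyPair A≤2)))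
  ... | u k , _ , _ , heavyPair = contradiction A≤2 (<⇒≱ (begin
    3                          ≤⟨ +-mono-≤ heavyPair 1≤Fx ⟩
    F u₀ + F (u k) + F x       ≡⟨ xy∙z≈xz∙y (F u₀) _ _ ⟩
    F u₀ + F x + F (u k)       ≤⟨ +-monoʳ-≤ (F u₀ + F x) (term≤∑ (F ∘ u) k) ⟩
    A                          ∎))
    where open ≤-Reasoning

  B≤2⇒Fy≥1⇒Fw≡0 : B ≤ 2 → 1 ≤ F y → ∀ i → F (w i) ≡ 0
  B≤2⇒Fy≥1⇒Fw≡0 B≤2 1≤Fy i with heavy w₀
  ... | y , _ , _ , heavyPair =
    n≤0⇒n≡0 (≤-trans (term≤∑ (F ∘ w) i) (≤-reflexive (m+n≤k≤m⇒n≡0 heavyPair B≤2)))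
  ... | w k , _ , _ , heavyPair = contradiction B≤2 (<⇒≱ (begin
    3                          ≤⟨ +-mono-≤ heavyPair 1≤Fy ⟩
    F w₀ + F (w k) + F y       ≡⟨ xy∙z≈xz∙y (F w₀) _ _ ⟩
    F w₀ + F y + F (w k)       ≤⟨ +-monoʳ-≤ (F w₀ + F y) (term≤∑ (F ∘ w) k) ⟩
    B                          ∎))
    where open ≤-Reasoning

  Fy≡0⇒Fu≡2⇒A+Fz≥4 : ∀ {l} → F y ≡ 0 → F (u l) ≡ 2 → 4 ≤ A + F z
  Fy≡0⇒Fu≡2⇒A+Fz≥4 {l} Fy≡0 Ful≡2 with heavy x
  ... | y , _ , 1≤Fy , _ = contradiction (subst (1 ≤_) Fy≡0 1≤Fy) λ ()
  ... | z , _ , _ , heavyPair = begin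
    4                          ≤⟨ +-mono-≤ heavyPair (≤-reflexive (sym Ful≡2)) ⟩
    F x + F z + F (u l)        ≤⟨ +-monoʳ-≤ (F x + F z) (term≤∑ (F ∘ u) l) ⟩
    F x + F z + U              ≤⟨ m≤n+m _ (F u₀) ⟩
    F u₀ + (F x + F z + U)     ≡⟨ rearrange (F u₀) (F x) (F z) U ⟩
    A + F z                    ∎
    where
    open ≤-Reasoning
    rearrange : ∀ a b c d → a + (b + c + d) ≡ a + b + d + c
    rearrange = solve-∀
  ... | u₀ , _ , _ , heavyPair = begin
    4                          ≤⟨ +-mono-≤ heavyPair (≤-reflexive (sym Ful≡2)) ⟩
    F x + F u₀ + F (u l)       ≤⟨ +-monoʳ-≤ (F x + F u₀) (term≤∑ (F ∘ u) l) ⟩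
    F x + F u₀ + U             ≡⟨ cong (_+ U) (+-comm (F x) (F u₀)) ⟩
    A                          ≤⟨ m≤m+n A (F z) ⟩
    A + F z                    ∎
    where open ≤-Reasoning

  module _ (z≤1 : F z ≤ 1) where

    A≤2⇒Fy≡2⊎W≥4 : A ≤ 2 → F y ≡ 2 ⊎ 4 ≤ W
    A≤2⇒Fy≡2⊎W≥4 A≤2 with ≡0⊎≥1 (F x)
    ... | inj₁ Fx≡0 with dominated x Fx≡0
    ...   | y , _ , two = inj₁ two
    ...   | z , _ , two = contradiction two (≤1⇒≢2 z≤1)
    ...   | u₀ , _ , two = contradiction two (≤1⇒≢2 (A≤2⇒Fu₀≤1 A≤2))
    A≤2⇒Fy≡2⊎W≥4 A≤2 | inj₂ 1≤Fx = ∑≥4-or i₀ twoNeighbour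
      where
      twoNeighbour : ∀ i → F y ≡ 2 ⊎ ∃[ j ] (j ≢ i × F (w j) ≡ 2)
      twoNeighbour i with dominated (u i) (A≤2⇒Fx≥1⇒Fu≡0 A≤2 1≤Fx i)
      ... | u j , _ , two = contradiction two (≡0⇒≢2 (A≤2⇒Fx≥1⇒Fu≡0 A≤2 1≤Fx j))
      ... | w j , i≠j , two = inj₂ (j , neq⇒≢ i≠j ∘ sym , two)
      ... | z , _ , two = contradiction two (≤1⇒≢2 z≤1)
      ... | y , _ , two = inj₁ two
      ... | u₀ , _ , two = contradiction two (≤1⇒≢2 (A≤2⇒Fu₀≤1 A≤2))

    A≤2⇒W+Fz+Fw₀≥2 : A ≤ 2 → 2 ≤ W + (F z + F w₀)
    A≤2⇒W+Fz+Fw₀≥2 A≤2 with 2 ≤? W + (F z + F w₀)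
    ... | yes heavySide = heavySide
    ... | no lightSide = contradiction A≤2 (<⇒≱ (≤-trans U≥3 (m≤n+m U (F u₀ + F x))))
      where
      light : W + (F z + F w₀) ≤ 1
      light = ≤-pred (≰⇒> lightSide)
      cross : ∀ i → ∃[ j ] (j ≢ i × 1 ≤ F (u j) × 2 ≤ F (w i) + F (u j))
      cross i with heavy (w i)
      ... | u j , i≠j , 1≤Fuj , heavyPair = j , neq⇒≢ i≠j ∘ sym , 1≤Fuj , heavyPair
      ... | w j , i≠j , _ , heavyPair = contradiction (≤-trans heavyPair (≤-trans
            (≤-trans (twoTerms≤∑ (F ∘ w) (neq⇒≢ i≠j)) (m≤m+n W _)) light)) 1+n≰n
      ... | z , _ , _ , heavyPair = contradiction (≤-trans heavyPair (≤-trans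
            (+-mono-≤ (term≤∑ (F ∘ w) i) (m≤m+n (F z) (F w₀))) light)) 1+n≰n
      ... | w₀ , _ , _ , heavyPair = contradiction (≤-trans heavyPair (≤-trans
            (+-mono-≤ (term≤∑ (F ∘ w) i) (m≤n+m (F w₀) (F z))) light)) 1+n≰n
      U≥3 : 3 ≤ U
      U≥3 = ∑≥3-of-crossing 2≤r (≤-trans (m≤m+n W _) light) cross

    B≤2⇒Fy≡0⇒U+Fz+Fu₀≥2 : B ≤ 2 → F y ≡ 0 → 2 ≤ U + (F z + F u₀)
    B≤2⇒Fy≡0⇒U+Fz+Fu₀≥2 B≤2 Fy≡0 with 2 ≤? U + (F z + F u₀)
    ... | yes heavySide = heavySide
    ... | no lightSide = contradiction B≤2 (<⇒≱ (≤-trans W≥3 (m≤n+m W (F w₀ + F y))))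
      where
      light : U + (F z + F u₀) ≤ 1
      light = ≤-pred (≰⇒> lightSide)
      cross : ∀ i → ∃[ j ] (j ≢ i × 1 ≤ F (w j) × 2 ≤ F (u i) + F (w j))
      cross i with heavy (u i)
      ... | w j , i≠j , 1≤Fwj , heavyPair = j , neq⇒≢ i≠j ∘ sym , 1≤Fwj , heavyPair
      ... | y , _ , 1≤Fy , _ = contradiction (subst (1 ≤_) Fy≡0 1≤Fy) λ ()
      ... | u j , i≠j , _ , heavyPair = contradiction (≤-trans heavyPair (≤-trans
            (≤-trans (twoTerms≤∑ (F ∘ u) (neq⇒≢ i≠j)) (m≤m+n U _)) light)) 1+n≰n
      ... | z , _ , _ , heavyPair = contradiction (≤-trans heavyPair (≤-trans
            (+-mono-≤ (term≤∑ (F ∘ u) i) (m≤m+n (F z) (F u₀))) light)) 1+n≰n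
      ... | u₀ , _ , _ , heavyPair = contradiction (≤-trans heavyPair (≤-trans
            (+-mono-≤ (term≤∑ (F ∘ u) i) (m≤n+m (F u₀) (F z))) light)) 1+n≰n
      W≥3 : 3 ≤ W
      W≥3 = ∑≥3-of-crossing 2≤r (≤-trans (m≤m+n U _) light) cross

    A≤2⇒B+Fz≥4 : A ≤ 2 → 4 ≤ B + F z
    A≤2⇒B+Fz≥4 A≤2 with A≤2⇒Fy≡2⊎W≥4 A≤2
    ... | inj₁ Fy≡2 = begin
      2 + 2                     ≤⟨ +-mono-≤ (≤-reflexive (sym Fy≡2)) (A≤2⇒W+Fz+Fw₀≥2 A≤2) ⟩
      F y + (W + (F z + F w₀))  ≡⟨ regroup (F w₀) (F y) W (F z) ⟩
      B + F z                   ∎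
      where open ≤-Reasoning
    ... | inj₂ W≥4 = ≤-trans W≥4 (≤-trans (m≤n+m W (F w₀ + F y)) (m≤m+n B (F z)))

    B≤2⇒A+Fz≥4 : B ≤ 2 → 4 ≤ A + F z
    B≤2⇒A+Fz≥4 B≤2 with ≡0⊎≥1 (F y)
    ... | inj₂ 1≤Fy = ≤-trans U≥4 (≤-trans (m≤n+m U (F u₀ + F x)) (m≤m+n A (F z)))
      where
      twoNeighbour : ∀ i → ⊥ ⊎ ∃[ j ] (j ≢ i × F (u j) ≡ 2)
      twoNeighbour i with dominated (w i) (B≤2⇒Fy≥1⇒Fw≡0 B≤2 1≤Fy i)
      ... | u j , i≠j , two = inj₂ (j , neq⇒≢ i≠j ∘ sym , two)
      ... | w j , _ , two = inj₁ (≡0⇒≢2 (B≤2⇒Fy≥1⇒Fw≡0 B≤2 1≤Fy j) two)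
      ... | z , _ , two = inj₁ (≤1⇒≢2 z≤1 two)
      ... | w₀ , _ , two = inj₁ (≤1⇒≢2 (B≤2⇒Fw₀≤1 B≤2) two)
      U≥4 : 4 ≤ U
      U≥4 = [ ⊥-elim , id ]′ (∑≥4-or i₀ twoNeighbour)
    ... | inj₁ Fy≡0 with dominated y Fy≡0
    ...   | u l , _ , two = Fy≡0⇒Fu≡2⇒A+Fz≥4 Fy≡0 two
    ...   | z , _ , two = contradiction two (≤1⇒≢2 z≤1)
    ...   | w₀ , _ , two = contradiction two (≤1⇒≢2 (B≤2⇒Fw₀≤1 B≤2))
    ...   | x , _ , two = begin
      2 + 2                     ≤⟨ +-mono-≤ (≤-reflexive (sym two)) (B≤2⇒Fy≡0⇒U+Fz+Fu₀≥2 B≤2 Fy≡0) ⟩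
      F x + (U + (F z + F u₀))  ≡⟨ regroup (F u₀) (F x) U (F z) ⟩
      A + F z                   ∎
      where open ≤-Reasoning

  A+B+Fz≥6 : 6 ≤ A + B + F z
  A+B+Fz≥6 with F z ≤? 1
  ... | no z≰1 = +-mono-≤ (+-mono-≤ A≥2 B≥2) (≰⇒> z≰1)
  ... | yes z≤1 with A ≤? 2 | B ≤? 2
  ...   | yes A≤2 | _ =
    ≤-trans (+-mono-≤ A≥2 (A≤2⇒B+Fz≥4 z≤1 A≤2)) (≤-reflexive (sym (+-assoc A B (F z))))
  ...   | no _ | yes B≤2 =
    ≤-trans (+-mono-≤ (B≤2⇒A+Fz≥4 z≤1 B≤2) B≥2) (≤-reflexive (xy∙z≈xz∙y A (F z) B))
  ...   | no A≰2 | no B≰2 = ≤-trans (+-mono-≤ (≰⇒> A≰2) (≰⇒> B≰2)) (m≤m+n (A + B) (F z))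

data NonAdjacent {r} : Vtx r → Vtx r → Set where
  x-w₀  : NonAdjacent x w₀
  x-u   : ∀ i → NonAdjacent x (u i)
  x-w   : ∀ i → NonAdjacent x (w i)
  y-u₀  : NonAdjacent y u₀
  y-w   : ∀ i → NonAdjacent y (w i)
  z-u₀  : NonAdjacent z u₀
  z-w₀  : NonAdjacent z w₀
  u₀-w₀ : NonAdjacent u₀ w₀
  u₀-w  : ∀ i → NonAdjacent u₀ (w i)
  w₀-u  : ∀ i → NonAdjacent w₀ (u i)
  u-w   : ∀ i → NonAdjacent (u i) (w i)

nonAdjacent : ∀ {r} (p q : Vtx r) → p ≢ q → ¬ T (vadj p q) → NonAdjacent p q ⊎ NonAdjacent q p
nonAdjacent x      x      p≢q _ = contradiction refl p≢q
nonAdjacent x      y      _ ¬p~q = contradiction tt ¬p~q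
nonAdjacent x      z      _ ¬p~q = contradiction tt ¬p~q
nonAdjacent x      u₀     _ ¬p~q = contradiction tt ¬p~q
nonAdjacent x      w₀     _ _ = inj₁ x-w₀
nonAdjacent x      (u j)  _ _ = inj₁ (x-u j)
nonAdjacent x      (w j)  _ _ = inj₁ (x-w j)
nonAdjacent y      x      _ ¬p~q = contradiction tt ¬p~q
nonAdjacent y      y      p≢q _ = contradiction refl p≢q
nonAdjacent y      z      _ ¬p~q = contradiction tt ¬p~q
nonAdjacent y      u₀     _ _ = inj₁ y-u₀
nonAdjacent y      w₀     _ ¬p~q = contradiction tt ¬p~q
nonAdjacent y      (u j)  _ ¬p~q = contradiction tt ¬p~q
nonAdjacent y      (w j)  _ _ = inj₁ (y-w j)
nonAdjacent z      x      _ ¬p~q = contradiction tt ¬p~q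
nonAdjacent z      y      _ ¬p~q = contradiction tt ¬p~q
nonAdjacent z      z      p≢q _ = contradiction refl p≢q
nonAdjacent z      u₀     _ _ = inj₁ z-u₀
nonAdjacent z      w₀     _ _ = inj₁ z-w₀
nonAdjacent z      (u j)  _ ¬p~q = contradiction tt ¬p~q
nonAdjacent z      (w j)  _ ¬p~q = contradiction tt ¬p~q
nonAdjacent u₀     x      _ ¬p~q = contradiction tt ¬p~q
nonAdjacent u₀     y      _ _ = inj₂ y-u₀
nonAdjacent u₀     z      _ _ = inj₂ z-u₀
nonAdjacent u₀     u₀     p≢q _ = contradiction refl p≢q
nonAdjacent u₀     w₀     _ _ = inj₁ u₀-w₀
nonAdjacent u₀     (u j)  _ ¬p~q = contradiction tt ¬p~q
nonAdjacent u₀     (w j)  _ _ = inj₁ (u₀-w j)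
nonAdjacent w₀     x      _ _ = inj₂ x-w₀
nonAdjacent w₀     y      _ ¬p~q = contradiction tt ¬p~q
nonAdjacent w₀     z      _ _ = inj₂ z-w₀
nonAdjacent w₀     u₀     _ _ = inj₂ u₀-w₀
nonAdjacent w₀     w₀     p≢q _ = contradiction refl p≢q
nonAdjacent w₀     (u j)  _ _ = inj₁ (w₀-u j)
nonAdjacent w₀     (w j)  _ ¬p~q = contradiction tt ¬p~q
nonAdjacent (u i)  x      _ _ = inj₂ (x-u i)
nonAdjacent (u i)  y      _ ¬p~q = contradiction tt ¬p~q
nonAdjacent (u i)  z      _ ¬p~q = contradiction tt ¬p~q
nonAdjacent (u i)  u₀     _ ¬p~q = contradiction tt ¬p~q
nonAdjacent (u i)  w₀     _ _ = inj₂ (w₀-u i)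
nonAdjacent (u i)  (u j)  p≢q ¬p~q = contradiction (cong u (¬neq⇒≡ ¬p~q)) p≢q
nonAdjacent (u i)  (w j)  _ ¬p~q with refl ← ¬neq⇒≡ ¬p~q = inj₁ (u-w i)
nonAdjacent (w i)  x      _ _ = inj₂ (x-w i)
nonAdjacent (w i)  y      _ _ = inj₂ (y-w i)
nonAdjacent (w i)  z      _ ¬p~q = contradiction tt ¬p~q
nonAdjacent (w i)  u₀     _ _ = inj₂ (u₀-w i)
nonAdjacent (w i)  w₀     _ ¬p~q = contradiction tt ¬p~q
nonAdjacent (w i)  (u j)  _ ¬p~q with refl ← ¬neq⇒≡ ¬p~q = inj₂ (u-w i)
nonAdjacent (w i)  (w j)  p≢q ¬p~q = contradiction (cong w (¬neq⇒≡ ¬p~q)) p≢q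

DominatingPair : ∀ {r} → (Vtx r → Vtx r → Set) → Set
DominatingPair {r} H = ∃[ s ] ∃[ t ] (∀ (p : Vtx r) → H p s ⊎ H p t)

module _ {r} (2≤r : 2 ≤ r) {H : Vtx r → Vtx r → Set} (old : ∀ {p q} → T (vadj p q) → H p q) where

  dominatingPair : ∀ {P Q} → NonAdjacent P Q → H P Q → H Q P → DominatingPair H
  dominatingPair x-w₀ _ w₀~x = x , z , λ where
    x → inj₂ (old tt) ; y → inj₁ (old tt) ; z → inj₁ (old tt) ; u₀ → inj₁ (old tt)
    w₀ → inj₁ w₀~x ; (u _) → inj₂ (old tt) ; (w _) → inj₂ (old tt)
  dominatingPair (x-u i) x~ui _ = let j , i≢j = another 2≤r i in u i , w j , λ where
    x → inj₁ x~ui ; y → inj₁ (old tt) ; z → inj₁ (old tt) ; u₀ → inj₁ (old tt) ; w₀ → inj₂ (old tt)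
    (u l) → ⊎-map old old (neq-either l i≢j)
    (w l) → ⊎-map old old (neq-either l i≢j)
  dominatingPair (x-w i) x~wi _ = let j , i≢j = another 2≤r i in w i , u j , λ where
    x → inj₁ x~wi ; y → inj₂ (old tt) ; z → inj₁ (old tt) ; u₀ → inj₂ (old tt) ; w₀ → inj₁ (old tt)
    (u l) → ⊎-map old old (neq-either l i≢j)
    (w l) → ⊎-map old old (neq-either l i≢j)
  dominatingPair y-u₀ _ u₀~y = y , z , λ where
    x → inj₁ (old tt) ; y → inj₂ (old tt) ; z → inj₁ (old tt) ; u₀ → inj₁ u₀~y
    w₀ → inj₁ (old tt) ; (u _) → inj₁ (old tt) ; (w _) → inj₂ (old tt)
  dominatingPair (y-w i) _ wi~y = y , u i , λ where
    x → inj₁ (old tt) ; y → inj₂ (old tt) ; z → inj₁ (old tt) ; u₀ → inj₂ (old tt)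
    w₀ → inj₁ (old tt) ; (u _) → inj₁ (old tt)
    (w l) → case l ≟ i of λ where
      (yes refl) → inj₁ wi~y
      (no l≢i) → inj₂ (old (≢⇒neq l≢i))
  dominatingPair z-u₀ _ u₀~z = let i = fromℕ< 2≤r in z , w i , λ where
    x → inj₁ (old tt) ; y → inj₁ (old tt) ; z → inj₂ (old tt) ; u₀ → inj₁ u₀~z
    w₀ → inj₂ (old tt) ; (u _) → inj₁ (old tt) ; (w _) → inj₁ (old tt)
  dominatingPair z-w₀ _ w₀~z = let i = fromℕ< 2≤r in z , u i , λ where
    x → inj₁ (old tt) ; y → inj₁ (old tt) ; z → inj₂ (old tt) ; u₀ → inj₂ (old tt)
    w₀ → inj₁ w₀~z ; (u _) → inj₁ (old tt) ; (w _) → inj₁ (old tt)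
  dominatingPair u₀-w₀ u₀~w₀ _ = y , w₀ , λ where
    x → inj₁ (old tt) ; y → inj₂ (old tt) ; z → inj₁ (old tt) ; u₀ → inj₂ u₀~w₀
    w₀ → inj₁ (old tt) ; (u _) → inj₁ (old tt) ; (w _) → inj₂ (old tt)
  dominatingPair (u₀-w i) u₀~wi _ = z , w i , λ where
    x → inj₁ (old tt) ; y → inj₁ (old tt) ; z → inj₂ (old tt) ; u₀ → inj₂ u₀~wi
    w₀ → inj₂ (old tt) ; (u _) → inj₁ (old tt) ; (w _) → inj₁ (old tt)
  dominatingPair (w₀-u i) w₀~ui _ = z , u i , λ where
    x → inj₁ (old tt) ; y → inj₁ (old tt) ; z → inj₂ (old tt) ; u₀ → inj₂ (old tt)
    w₀ → inj₂ w₀~ui ; (u _) → inj₁ (old tt) ; (w _) → inj₁ (old tt)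
  dominatingPair (u-w i) _ wi~ui = y , u i , λ where
    x → inj₁ (old tt) ; y → inj₂ (old tt) ; z → inj₁ (old tt) ; u₀ → inj₂ (old tt)
    w₀ → inj₁ (old tt) ; (u _) → inj₁ (old tt)
    (w l) → case l ≟ i of λ where
      (yes refl) → inj₂ wi~ui
      (no l≢i) → inj₂ (old (≢⇒neq l≢i))

totallyDominates-encode : ∀ {r} (H : Graph (5 + (r + r))) (D : List (Vtx r)) →
                   (∀ p → ∃[ s ] (s ∈ D × Adj H (encode p) (encode s))) → TotallyDominates H (map encode D)
totallyDominates-encode {r} H D dom v =
  let s , s∈D , p~s = dom (decode {r} v) in
  encode s , ∈-map⁺ encode s∈D , subst (λ a → Adj H a (encode s)) (encode-decode {r} v) p~s

xyz-dominates : ∀ {r} (p : Vtx r) → ∃[ s ] (s ∈ x ∷ y ∷ z ∷ [] × T (vadj p s))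
xyz-dominates x = y , there (here refl) , tt
xyz-dominates y = x , here refl , tt
xyz-dominates z = x , here refl , tt
xyz-dominates u₀ = x , here refl , tt
xyz-dominates w₀ = y , there (here refl) , tt
xyz-dominates (u _) = z , there (there (here refl)) , tt
xyz-dominates (w _) = z , there (there (here refl)) , tt

xyz-totallyDominates : ∀ r → TotallyDominates (G r) (map (encode {r}) (x ∷ y ∷ z ∷ []))
xyz-totallyDominates r = totallyDominates-encode {r} (G r) (x ∷ y ∷ z ∷ []) λ p →
  let s , s∈ , p~s = xyz-dominates p in s , s∈ , vadj⇒Adj {p = p} {s} p~s

IsTRDF-weight≥6 : ∀ {r} → 2 ≤ r → ∀ f → IsTRDF (G r) f → 6 ≤ weight f
IsTRDF-weight≥6 {r} 2≤r f trdf =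
  subst (6 ≤_) (sym (weight-sides {r} f)) (LowerBound.A+B+Fz≥6 2≤r (IsTRDF-encode {r} trdf))

dominatingPair⇒γtR≤4 : ∀ {r} (H : Graph (5 + (r + r))) →
                           DominatingPair {r} (λ p q → Adj H (encode p) (encode q)) → γtR≤ H 4
dominatingPair⇒γtR≤4 {r} H (s , t , dom) =
  γtR≤-totalDomination H (map encode (s ∷ t ∷ [])) (totallyDominates-encode {r} H (s ∷ t ∷ []) member)
  where
  member : ∀ p → ∃[ v ] (v ∈ s ∷ t ∷ [] × Adj H (encode p) (encode v))
  member p with dom p
  ... | inj₁ p~s = s , here refl , p~s
  ... | inj₂ p~t = t , there (here refl) , p~t

addEdge-γtR≤4 : ∀ {r} → 2 ≤ r → ∀ a b → NonEdge (G r) a b → γtR≤ (addEdge (G r) a b) 4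
addEdge-γtR≤4 {r} 2≤r a b (a≢b , ¬a~b) =
  dominatingPair⇒γtR≤4 H (pairFor (nonAdjacent (decode a) (decode b) da≢db ¬a~b))
  where
  H = addEdge (G r) a b
  H′ : Vtx r → Vtx r → Set
  H′ p q = Adj H (encode p) (encode q)
  old : ∀ {p q} → T (vadj p q) → H′ p q
  old {p} {q} p~q = addEdge-⊇ (G r) a b {encode p} {encode q} (vadj⇒Adj {p = p} {q} p~q)
  new : ∀ c d → Adj H c d → H′ (decode c) (decode d)
  new c d = subst₂ (Adj H) (sym (encode-decode {r} c)) (sym (encode-decode {r} d))
  a~b : H′ (decode a) (decode b)
  a~b = new a b (addEdge-new (G r) a b)
  b~a : H′ (decode b) (decode a)
  b~a = new b a (addEdge-new′ (G r) a b)
  da≢db : decode {r} a ≢ decode b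
  da≢db da≡db = a≢b (trans (sym (encode-decode a)) (trans (cong encode da≡db) (encode-decode b)))
  pairFor : NonAdjacent (decode a) (decode b) ⊎ NonAdjacent (decode b) (decode a) → DominatingPair H′
  pairFor (inj₁ a≁b) = dominatingPair 2≤r (λ {p} {q} → old {p} {q}) a≁b a~b b~a
  pairFor (inj₂ b≁a) = dominatingPair 2≤r (λ {p} {q} → old {p} {q}) b≁a b~a a~b

theorem6p3 : (r : ℕ) → 2 ≤ r → EdgeSupercritical 6 (G r)
theorem6p3 r 2≤r =
    TotallyDominates⇒NoIsolated (xyz-totallyDominates r)
  , γtR≡-intro (γtR≤-totalDomination (G r) (map (encode {r}) (x ∷ y ∷ z ∷ [])) (xyz-totallyDominates r))
               (IsTRDF-weight≥6 2≤r)
  , (encode {r} x , encode {r} w₀ , (λ ()) , λ ())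
  , addEdge-γtR≤4 2≤r
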